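{- Let $k,n\ge 3$ be integers and suppose $H$ is a red matching with $m$ edges. Then for any two vertices $s_1,s_2\notin V(H)$, Builder in the game $\tilde R_H(C_k,C_n)$ has a strategy such that one of the following holds: (i) for some integer $t<m$, after at most $2t+6$ rounds the host graph contains pairwise vertex-disjoint two wish triangles and a blue path on $t$ vertices, such that if $t\ge 2$ then this path has an endpoint in $\{s_1,s_2\}$; (ii) after $2m$ rounds the host graph contains a dragon tail of length $m-2$ that starts in $s_1$ or in $s_2$.
   Context: Online Ramsey game: Builder and Painter play on the infinite complete graph $K_{\mathbb N}$. For a colored graph $H$ (each edge red or blue), the game $\tilde R_H(G_1,G_2)$ starts with a copy of $H$ already drawn and colored on the board; in each round Builder selects a previously unselected edge and Painter colors it red or blue; the game ends as soon as the graph of all colored edges (the host graph) contains a red copy of $G_1$ or a blue copy of $G_2$. $C_k$ is the cycle on $k$ vertices. A wish triangle is a colored triangle $C_3$ whose three edges are either all red, or one red and two blue. A dragon tail $\mathcal T(\ell)$ of length $\ell$ is the colored graph consisting of a red path $u_0w_1u_1w_2u_2\dots w_\ell u_\ell$ of length $2\ell$ together with the blue path $u_0u_1\dots u_\ell$ (i.e. every other vertex of the red path, starting from an endpoint, joined into a blue path); it starts in $u_0$. -}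

module Defs where

open import Data.Nat using (ℕ; zero; suc; _+_; _*_; _∸_; _≤_; _<_)
open import Data.Product using (Σ; ∃; _×_; _,_; proj₁; proj₂)
open import Data.Sum using (_⊎_)
open import Data.List using (List; []; _∷_; map; upTo; concatMap; length; _++_)
open import Data.List.Membership.Propositional using (_∈_; _∉_)
open import Data.List.Relation.Unary.Unique.Propositional using (Unique)
open import Relation.Binary.PropositionalEquality using (_≡_; _≢_)
open import Relation.Nullary using (¬_)

data Color : Set where
  red blue : Color

-- A board (the coloured host graph) on the vertex set ℕ of K_ℕ:
-- the list of coloured edges, newest first.  An entry (u , v , c)
-- is the undirected edge uv coloured c.
Board : Set
Board = List (ℕ × ℕ × Color)

HasEdge : Board → Color → ℕ → ℕ → Set
HasEdge b c u v = ((u , v , c) ∈ b) ⊎ ((v , u , c) ∈ b)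

Adj : Board → ℕ → ℕ → Set
Adj b u v = Σ Color λ c → HasEdge b c u v

verts : List (ℕ × ℕ) → List ℕ
verts = concatMap (λ e → proj₁ e ∷ proj₂ e ∷ [])

-- A matching: all 2m endpoints pairwise distinct (hence also no loops).
IsMatching : List (ℕ × ℕ) → Set
IsMatching H = Unique (verts H)

redBoard : List (ℕ × ℕ) → Board
redBoard = map (λ e → (proj₁ e , proj₂ e , red))

-- Builder strategy: given the current board (which is the whole history),
-- select a previously unselected edge uv (u ≠ v).
Builder : Set
Builder = (b : Board) → Σ (ℕ × ℕ) λ e → (proj₁ e ≢ proj₂ e) × ¬ Adj b (proj₁ e) (proj₂ e)

Painter : Set
Painter = Board → ℕ × ℕ → Color

play : List (ℕ × ℕ) → Builder → Painter → ℕ → Board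
play H β π zero = redBoard H
play H β π (suc r) =
  let b = play H β π r
      e = proj₁ (β b)
  in (proj₁ e , proj₂ e , π b e) ∷ b

ContainsCycle : Board → Color → ℕ → Set
ContainsCycle b c k = Σ (ℕ → ℕ) λ f →
  Unique (map f (upTo k)) ×
  (∀ i → suc i < k → HasEdge b c (f i) (f (suc i))) ×
  HasEdge b c (f (k ∸ 1)) (f 0)

Ended : ℕ → ℕ → Board → Set
Ended k n b = ContainsCycle b red k ⊎ ContainsCycle b blue n

isRed : Color → ℕ
isRed red = 1
isRed blue = 0

WishColors : Color → Color → Color → Set
WishColors c₁ c₂ c₃ = (isRed c₁ + isRed c₂ + isRed c₃ ≡ 3) ⊎ (isRed c₁ + isRed c₂ + isRed c₃ ≡ 1)

-- x y z span a wish triangle in the host graph (distinctness imposed separately).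
WishTriangle : Board → ℕ → ℕ → ℕ → Set
WishTriangle b x y z = Σ Color λ c₁ → Σ Color λ c₂ → Σ Color λ c₃ →
  HasEdge b c₁ x y × HasEdge b c₂ y z × HasEdge b c₃ z x × WishColors c₁ c₂ c₃

-- g 0, …, g (t-1) is a blue path (vertex distinctness imposed separately).
BluePath : Board → ℕ → (ℕ → ℕ) → Set
BluePath b t g = ∀ i → suc i < t → HasEdge b blue (g i) (g (suc i))

InPair : ℕ → ℕ → ℕ → Set
InPair s₁ s₂ x = (x ≡ s₁) ⊎ (x ≡ s₂)

OutcomeI : Board → ℕ → ℕ → ℕ → Set
OutcomeI b s₁ s₂ t =
  Σ ℕ λ x₁ → Σ ℕ λ y₁ → Σ ℕ λ z₁ → Σ ℕ λ x₂ → Σ ℕ λ y₂ → Σ ℕ λ z₂ → Σ (ℕ → ℕ) λ g →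
    Unique (x₁ ∷ y₁ ∷ z₁ ∷ x₂ ∷ y₂ ∷ z₂ ∷ map g (upTo t)) ×
    WishTriangle b x₁ y₁ z₁ × WishTriangle b x₂ y₂ z₂ ×
    BluePath b t g ×
    (2 ≤ t → InPair s₁ s₂ (g 0) ⊎ InPair s₁ s₂ (g (t ∸ 1)))

DragonTail : Board → ℕ → ℕ → ℕ → Set
DragonTail b ℓ s₁ s₂ = Σ (ℕ → ℕ) λ u → Σ (ℕ → ℕ) λ w →
  Unique (map u (upTo (suc ℓ)) ++ map (λ i → w (suc i)) (upTo ℓ)) ×
  (∀ i → i < ℓ →
     HasEdge b red (u i) (w (suc i)) ×
     HasEdge b red (w (suc i)) (u (suc i)) ×
     HasEdge b blue (u i) (u (suc i))) ×
  InPair s₁ s₂ (u 0)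

-- Builder keeps a current vertex, starting at s₁, and in step j joins it to both endpoints of the
-- j-th matching edge. If the two new edges have the same colour they close a wish triangle with
-- that red edge; otherwise the red edge, the red new edge and the blue new edge form one more link
-- of a dragon tail whose new end is the endpoint joined in blue. At the first triangle Builder
-- backs up to the previous tail vertex (to s₂ if the triangle used s₁), so the tail is at most
-- two links shorter than the number of steps played, and it never returns to the vertex it left.
-- If a second triangle follows at step T₂, the first T₂ − 2 tail vertices form a blue path from
-- s₁ or s₂ avoiding both triangles (the second one uses the last tail vertex): outcome (i).
-- Otherwise after m steps the tail has length at least m − 2: outcome (ii).

module Submission where

open import Defs
open import Data.Bool using (Bool; true; false; not; _∧_; if_then_else_)
open import Data.Empty using (⊥-elim)
open import Data.List using (List; []; _∷_; length; map; upTo; _++_)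
open import Data.List.Extrema.Nat using (max; xs≤max)
open import Data.List.Membership.Propositional using (_∈_; _∉_)
open import Data.List.Membership.Propositional.Properties using (∈-map⁻; ∈-upTo⁻)
open import Data.List.Properties using (length-map; map-upTo; map-∘)
open import Data.List.Relation.Binary.Disjoint.Propositional using (Disjoint)
open import Data.List.Relation.Unary.All as All using (All; []; _∷_)
open import Data.List.Relation.Unary.All.Properties using (¬Any⇒All¬)
open import Data.List.Relation.Unary.AllPairs using ([]; _∷_)
open import Data.List.Relation.Unary.Any using (here; there)
open import Data.List.Relation.Unary.Unique.Propositional using (Unique)
open import Data.List.Relation.Unary.Unique.Propositional.Properties using (applyUpTo⁺₁; ++⁺; map⁺)
open import Data.Nat using (ℕ; zero; suc; pred; _+_; _*_; _∸_; _≤_; _<_; z≤n; s≤s; _≟_; _<?_; _≤?_; ⌊_/2⌋; parity)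
open import Data.Nat.Properties
open import Data.Parity.Base using (Parity; 0ℙ; 1ℙ; _⁻¹)
open import Data.Parity.Properties using (p≢p⁻¹)
open import Data.Product using (Σ; ∃; _×_; _,_; proj₁; proj₂)
open import Data.Product.Properties using (≡-dec)
open import Data.Sum using (_⊎_; inj₁; inj₂)
import Data.Sum as Sum
open import Function using (_∘_; id)
open import Relation.Binary.Definitions using (DecidableEquality)
open import Relation.Binary.PropositionalEquality
open import Relation.Nullary using (¬_; Dec; yes; no; ¬?)
open import Relation.Nullary.Decidable using (_×-dec_; _⊎-dec_)

private
  variable
    A : Set

prepend : List A → (ℕ → A) → ℕ → A
prepend []       d i       = d i
prepend (x ∷ xs) d zero    = x
prepend (x ∷ xs) d (suc i) = prepend xs (d ∘ suc) i

prepend-cases : ∀ (xs : List A) d i → prepend xs d i ∈ xs ⊎ ∃ λ k → prepend xs d i ≡ d k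
prepend-cases []       d i       = inj₂ (i , refl)
prepend-cases (x ∷ xs) d zero    = inj₁ (here refl)
prepend-cases (x ∷ xs) d (suc i) with prepend-cases xs (d ∘ suc) i
... | inj₁ mem     = inj₁ (there mem)
... | inj₂ (k , e) = inj₂ (suc k , e)

prepend-avoids : ∀ {x : A} {xs d} → All (x ≢_) xs → (∀ k → x ≢ d k) → ∀ i → x ≢ prepend xs d i
prepend-avoids {xs = xs} {d} x∉xs x≢d i eq with prepend-cases xs d i
... | inj₁ mem     = All.lookup x∉xs mem eq
... | inj₂ (k , e) = x≢d k (trans eq e)

prepend-injective : ∀ {xs : List A} {d} → Unique xs → (∀ {k k'} → d k ≡ d k' → k ≡ k') →
  (∀ k → d k ∉ xs) → ∀ {i j} → prepend xs d i ≡ prepend xs d j → i ≡ j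
prepend-injective {xs = []} _ d-inj _ eq = d-inj eq
prepend-injective {xs = x ∷ xs} _ _ _ {zero} {zero} _ = refl
prepend-injective {xs = x ∷ xs} (x∉xs ∷ _) _ d∉ {zero} {suc j} eq =
  ⊥-elim (prepend-avoids x∉xs (λ k e → d∉ (suc k) (here (sym e))) j eq)
prepend-injective {xs = x ∷ xs} (x∉xs ∷ _) _ d∉ {suc i} {zero} eq =
  ⊥-elim (prepend-avoids x∉xs (λ k e → d∉ (suc k) (here (sym e))) i (sym eq))
prepend-injective {xs = x ∷ xs} (_ ∷ uq) d-inj d∉ {suc i} {suc j} eq =
  cong suc (prepend-injective uq (suc-injective ∘ d-inj) (λ k → d∉ (suc k) ∘ there) eq)

above : List ℕ → ℕ → ℕ
above xs k = suc (max 0 xs) + k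

above-∉ : ∀ xs k → above xs k ∉ xs
above-∉ xs k mem = 1+n≰n (≤-trans (m≤m+n _ k) (All.lookup (xs≤max 0 xs) mem))

above-injective : ∀ xs {k k'} → above xs k ≡ above xs k' → k ≡ k'
above-injective xs = +-cancelˡ-≡ (suc (max 0 xs)) _ _

∈-map-upTo⁻ : ∀ {f : ℕ → A} {n x} → x ∈ map f (upTo n) → ∃ λ i → i < n × x ≡ f i
∈-map-upTo⁻ {f = f} mem with i , i∈ , refl ← ∈-map⁻ f mem = i , ∈-upTo⁻ i∈ , refl

All≢-map-upTo : ∀ {f : ℕ → A} {n x} → (∀ {i} → i < n → x ≢ f i) → All (x ≢_) (map f (upTo n))
All≢-map-upTo {f = f} {n} {x} x≢f = All.tabulate avoid
  where
  avoid : ∀ {y} → y ∈ map f (upTo n) → x ≢ y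
  avoid mem with i , i<n , refl ← ∈-map-upTo⁻ {f = f} mem = x≢f i<n

Unique-map-upTo : ∀ (f : ℕ → A) n → (∀ {i j} → i < n → j < n → f i ≡ f j → i ≡ j) →
  Unique (map f (upTo n))
Unique-map-upTo f n f-inj = subst Unique (sym (map-upTo f n))
  (applyUpTo⁺₁ f n λ i<j j<n e → <⇒≢ i<j (f-inj (<-trans i<j j<n) j<n e))

FalseOn : (ℕ → Bool) → ℕ → ℕ → Set
FalseOn f lo n = ∀ k → lo ≤ k → k < n → f k ≡ false

FalseOn-snoc : ∀ {f lo n} → FalseOn f lo n → (lo ≤ n → f n ≡ false) → FalseOn f lo (suc n)
FalseOn-snoc none fn k lo≤k k<1+n with m<1+n⇒m<n∨m≡n k<1+n
... | inj₁ k<n  = none k lo≤k k<n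
... | inj₂ refl = fn lo≤k

first-true : ∀ f lo n → FalseOn f lo n ⊎ ∃ λ k → lo ≤ k × k < n × f k ≡ true × FalseOn f lo k
first-true f lo zero = inj₁ λ _ _ ()
first-true f lo (suc n) with first-true f lo n
... | inj₂ (k , lo≤k , k<n , fk , below) = inj₂ (k , lo≤k , m<n⇒m<1+n k<n , fk , below)
... | inj₁ none with lo ≤? n | f n in fn
...   | yes lo≤n | true  = inj₂ (n , lo≤n , n<1+n n , fn , none)
...   | yes _    | false = inj₁ (FalseOn-snoc none λ _ → fn)
...   | no lo≰n  | _     = inj₁ (FalseOn-snoc none λ lo≤n → ⊥-elim (lo≰n lo≤n))

double : ℕ → ℕ
double zero    = zero
double (suc j) = suc (suc (double j))

double≡2* : ∀ j → double j ≡ 2 * j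
double≡2* zero    = refl
double≡2* (suc j) = trans (cong (suc ∘ suc) (double≡2* j)) (sym (*-suc 2 j))

double-mono-≤ : ∀ {i j} → i ≤ j → double i ≤ double j
double-mono-≤ z≤n       = z≤n
double-mono-≤ (s≤s i≤j) = s≤s (s≤s (double-mono-≤ i≤j))

round : ℕ → Parity → ℕ
round j 0ℙ = double j
round j 1ℙ = suc (double j)

round-suc : ∀ j p → round (suc j) p ≡ suc (suc (round j p))
round-suc j 0ℙ = refl
round-suc j 1ℙ = refl

⌊round/2⌋ : ∀ j p → ⌊ round j p /2⌋ ≡ j
⌊round/2⌋ zero    0ℙ = refl
⌊round/2⌋ zero    1ℙ = refl
⌊round/2⌋ (suc j) 0ℙ = cong suc (⌊round/2⌋ j 0ℙ)
⌊round/2⌋ (suc j) 1ℙ = cong suc (⌊round/2⌋ j 1ℙ)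

parity-round : ∀ j p → parity (round j p) ≡ p
parity-round zero    0ℙ = refl
parity-round zero    1ℙ = refl
parity-round (suc j) 0ℙ = parity-round j 0ℙ
parity-round (suc j) 1ℙ = parity-round j 1ℙ

round-⌊/2⌋ : ∀ r → round ⌊ r /2⌋ (parity r) ≡ r
round-⌊/2⌋ zero          = refl
round-⌊/2⌋ (suc zero)    = refl
round-⌊/2⌋ (suc (suc r)) = trans (round-suc ⌊ r /2⌋ (parity r)) (cong (suc ∘ suc) (round-⌊/2⌋ r))

round-injective : ∀ {i j p q} → round i p ≡ round j q → i ≡ j × p ≡ q
round-injective {i} {j} {p} {q} e =
  trans (sym (⌊round/2⌋ i p)) (trans (cong ⌊_/2⌋ e) (⌊round/2⌋ j q)) ,
  trans (sym (parity-round i p)) (trans (cong parity e) (parity-round j q))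

double≤round : ∀ j p → double j ≤ round j p
double≤round j 0ℙ = ≤-refl
double≤round j 1ℙ = n≤1+n (double j)

double⌊/2⌋≤ : ∀ r → double ⌊ r /2⌋ ≤ r
double⌊/2⌋≤ r = subst (double ⌊ r /2⌋ ≤_) (round-⌊/2⌋ r) (double≤round ⌊ r /2⌋ (parity r))

-- root 0ℙ, root 1ℙ name s₁, s₂ and end j p the endpoint p of the j-th matching edge (a fresh
-- vertex when j ≥ m); slot l is the position of l in the sequence s₁ ∷ s₂ ∷ verts H followed by
-- fresh vertices.
data Label : Set where
  root : Parity → Label
  end  : ℕ → Parity → Label

slot : Label → ℕ
slot (root p)  = round 0 p
slot (end j p) = round (suc j) p

slot-injective : ∀ {l l'} → slot l ≡ slot l' → l ≡ l'
slot-injective {root p}  {root q}  e = cong root (proj₂ (round-injective {0} {0} {p} {q} e))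
slot-injective {root p}  {end j q} e = ⊥-elim (0≢1+n (proj₁ (round-injective {0} {suc j} {p} {q} e)))
slot-injective {end i p} {root q}  e = ⊥-elim (0≢1+n (sym (proj₁ (round-injective {suc i} {0} {p} {q} e))))
slot-injective {end i p} {end j q} e with refl , refl ← round-injective {suc i} {suc j} {p} {q} e = refl

-- Builder's edges before round born l do not involve l: end j p is first used in round round j p.
born : Label → ℕ
born (root _)  = 0
born (end j p) = suc (round j p)

sameColour : Color → Color → Bool
sameColour red  red  = true
sameColour blue blue = true
sameColour red  blue = false
sameColour blue red  = false

blueSide : Color → Parity
blueSide red  = 1ℙ
blueSide blue = 0ℙ

-- c r is the colour of round r; step j consists of rounds round j 0ℙ and round j 1ℙ, which join
-- current c j to end j 0ℙ and end j 1ℙ.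
Colouring : Set
Colouring = ℕ → Color

closesTriangle : Colouring → ℕ → Bool
closesTriangle c j = sameColour (c (round j 0ℙ)) (c (round j 1ℙ))

blueEnd redEnd : Colouring → ℕ → Label
blueEnd c j = end j (blueSide (c (round j 0ℙ)))
redEnd  c j = end j (blueSide (c (round j 0ℙ)) ⁻¹)

triangleFree : Colouring → ℕ → Bool
triangleFree c zero    = true
triangleFree c (suc j) = not (closesTriangle c j) ∧ triangleFree c j

-- The vertex before current c j on a triangle-free tail; s₂ takes over when the triangle used s₁.
retreat : Colouring → ℕ → Label
retreat c zero          = root 1ℙ
retreat c (suc zero)    = root 0ℙ
retreat c (suc (suc k)) = blueEnd c k

-- After the second triangle the play is decided, so the choice root 0ℙ there is arbitrary.
current : Colouring → ℕ → Label
current c zero    = root 0ℙ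
current c (suc j) =
  if closesTriangle c j
  then (if triangleFree c j then retreat c j else root 0ℙ)
  else blueEnd c j

current-open : ∀ c {j} → closesTriangle c j ≡ false → current c (suc j) ≡ blueEnd c j
current-open c notClosed rewrite notClosed = refl

current-first : ∀ c {j} → closesTriangle c j ≡ true → triangleFree c j ≡ true → current c (suc j) ≡ retreat c j
current-first c closes free rewrite closes | free = refl

triangleFree⇒open : ∀ c {j k} → triangleFree c j ≡ true → k < j → closesTriangle c k ≡ false
triangleFree⇒open c {suc j} {k} free k<1+j with closesTriangle c j in closes | triangleFree c j in free'
triangleFree⇒open c {suc j} {k} () k<1+j | true  | _
triangleFree⇒open c {suc j} {k} () k<1+j | false | false
... | false | true with m<1+n⇒m<n∨m≡n k<1+j
...   | inj₁ k<j  = triangleFree⇒open c free' k<j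
...   | inj₂ refl = closes

open⇒triangleFree : ∀ c j → FalseOn (closesTriangle c) 0 j → triangleFree c j ≡ true
open⇒triangleFree c zero    _    = refl
open⇒triangleFree c (suc j) none rewrite none j z≤n (n<1+n j) =
  open⇒triangleFree c j λ k _ k<j → none k z≤n (m<n⇒m<1+n k<j)

current-cases : ∀ c j → (∃ λ p → current c j ≡ root p) ⊎
  (∃ λ k → k < j × closesTriangle c k ≡ false × current c j ≡ blueEnd c k)
current-cases c zero = inj₁ (0ℙ , refl)
current-cases c (suc j) with closesTriangle c j in closes | triangleFree c j in free
... | false | _     = inj₂ (j , n<1+n j , closes , refl)
... | true  | false = inj₁ (0ℙ , refl)
... | true  | true  = retreat-cases j free
  where
  retreat-cases : ∀ j → triangleFree c j ≡ true → (∃ λ p → retreat c j ≡ root p) ⊎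
    (∃ λ k → k < suc j × closesTriangle c k ≡ false × retreat c j ≡ blueEnd c k)
  retreat-cases zero                _    = inj₁ (1ℙ , refl)
  retreat-cases (suc zero)          _    = inj₁ (0ℙ , refl)
  retreat-cases (suc (suc k)) free =
    inj₂ (k , m<n⇒m<1+n (m<n⇒m<1+n (n<1+n k)) , triangleFree⇒open c free (m<n⇒m<1+n (n<1+n k)) , refl)

born-end : ∀ j p → born (end j p) ≤ double (suc j)
born-end j 0ℙ = n≤1+n _
born-end j 1ℙ = ≤-refl

born-current : ∀ c j → born (current c j) ≤ double j
born-current c j with current-cases c j
... | inj₁ (p , e)              rewrite e = z≤n
... | inj₂ (k , k<j , _ , e)   rewrite e = ≤-trans (born-end k (blueSide (c (round k 0ℙ)))) (double-mono-≤ k<j)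

current≢end : ∀ c j q → current c j ≢ end j q
current≢end c j q e = <⇒≱ (s≤s (double≤round j q)) (subst (λ l → born l ≤ double j) e (born-current c j))

-- Builder can read off the colouring only for the rounds already played.
AgreeBelow : ℕ → Colouring → Colouring → Set
AgreeBelow n c c' = ∀ {r} → r < n → c r ≡ c' r

AgreeBelow-≤ : ∀ {m n c c'} → m ≤ n → AgreeBelow n c c' → AgreeBelow m c c'
AgreeBelow-≤ m≤n agree r<m = agree (≤-trans r<m m≤n)

AgreeBelow-step : ∀ {j c c'} → AgreeBelow (double (suc j)) c c' → AgreeBelow (double j) c c'
AgreeBelow-step = AgreeBelow-≤ (m≤n⇒m≤1+n (n≤1+n _))

closesTriangle-cong : ∀ {c c'} j → AgreeBelow (double (suc j)) c c' → closesTriangle c j ≡ closesTriangle c' j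
closesTriangle-cong j agree = cong₂ sameColour (agree (s≤s (n≤1+n _))) (agree ≤-refl)

blueEnd-cong : ∀ {c c'} j → AgreeBelow (double (suc j)) c c' → blueEnd c j ≡ blueEnd c' j
blueEnd-cong j agree = cong (end j ∘ blueSide) (agree (s≤s (n≤1+n _)))

triangleFree-cong : ∀ {c c'} j → AgreeBelow (double j) c c' → triangleFree c j ≡ triangleFree c' j
triangleFree-cong zero    _     = refl
triangleFree-cong (suc j) agree =
  cong₂ (λ a b → not a ∧ b) (closesTriangle-cong j agree) (triangleFree-cong j (AgreeBelow-step agree))

retreat-cong : ∀ {c c'} j → AgreeBelow (double j) c c' → retreat c j ≡ retreat c' j
retreat-cong zero          _     = refl
retreat-cong (suc zero)    _     = refl
retreat-cong (suc (suc k)) agree = blueEnd-cong k (AgreeBelow-step agree)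

current-cong : ∀ {c c'} j → AgreeBelow (double j) c c' → current c j ≡ current c' j
current-cong zero    _     = refl
current-cong (suc j) agree
  rewrite closesTriangle-cong j agree | triangleFree-cong j (AgreeBelow-step agree)
        | retreat-cong j (AgreeBelow-step agree) | blueEnd-cong j agree = refl

stepOf : Label → ℕ
stepOf (root _)  = 0
stepOf (end j _) = j

sideOf : Label → Parity
sideOf (root p)  = p
sideOf (end _ p) = p

blueEnd≢redEnd : ∀ c i k → blueEnd c i ≢ redEnd c k
blueEnd≢redEnd c i k e with refl ← cong stepOf e = p≢p⁻¹ _ (cong sideOf e)

blueEnd≢closedEnd : ∀ c {i k q} → closesTriangle c i ≡ false → closesTriangle c k ≡ true → blueEnd c i ≢ end k q
blueEnd≢closedEnd c notClosed closed e with refl ← cong stepOf e with () ← trans (sym notClosed) closed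

current≢closedEnd : ∀ c j {k q} → closesTriangle c k ≡ true → current c j ≢ end k q
current≢closedEnd c j closed e with current-cases c j
... | inj₁ (p , e₀)                 with () ← trans (sym e₀) e
... | inj₂ (i , _ , notClosed , e₀) = blueEnd≢closedEnd c notClosed closed (trans (sym e₀) e)

current≢blueEnd : ∀ c {T j} → T ≤ j → current c T ≢ blueEnd c j
current≢blueEnd c {T} T≤j e with current-cases c T
... | inj₁ (p , e₀)           with () ← trans (sym e₀) e
... | inj₂ (i , i<T , _ , e₀) = <⇒≢ (<-≤-trans i<T T≤j) (cong stepOf (trans (sym e₀) e))

tailVertex : Colouring → Parity → (ℕ → ℕ) → ℕ → Label
tailVertex c p step zero    = root p
tailVertex c p step (suc i) = blueEnd c (step i)

-- The strategy's dragon tail at step j, with u_i = vertex i and w_(i+1) = redEnd c (step i), link i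
-- having been made at step `step i`; its last vertex is current c j.
record Tail (c : Colouring) (j : ℕ) : Set where
  field
    base            : Parity
    size            : ℕ
    step            : ℕ → ℕ
    step<j          : ∀ {i} → i < size → step i < j
    step-open       : ∀ {i} → i < size → closesTriangle c (step i) ≡ false
    step-current    : ∀ {i} → i < size → current c (step i) ≡ tailVertex c base step i
    step-injective  : ∀ {i i'} → i < size → i' < size → step i ≡ step i' → i ≡ i'
    ends-at-current : current c j ≡ tailVertex c base step size
    j≤2+size        : j ≤ 2 + size

  vertex : ℕ → Label
  vertex = tailVertex c base step

  vertex-injective : ∀ {i i'} → i ≤ size → i' ≤ size → vertex i ≡ vertex i' → i ≡ i'
  vertex-injective {zero}  {zero}   _   _    _ = refl
  vertex-injective {zero}  {suc _}  _   _    ()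
  vertex-injective {suc _} {zero}   _   _    ()
  vertex-injective {suc i} {suc i'} i<n i'<n e = cong suc (step-injective i<n i'<n (cong stepOf e))

  vertex≢redEnd : ∀ i k → vertex i ≢ redEnd c k
  vertex≢redEnd zero    k ()
  vertex≢redEnd (suc i) k = blueEnd≢redEnd c (step i) k

  vertex≢closedEnd : ∀ {i k q} → closesTriangle c k ≡ true → i ≤ size → vertex i ≢ end k q
  vertex≢closedEnd {zero}  _      _   ()
  vertex≢closedEnd {suc i} closed i<n = blueEnd≢closedEnd c (step-open i<n) closed

  Avoids : Label → Set
  Avoids x = ∀ {i} → i ≤ size → vertex i ≢ x

initialTail : ∀ c j → FalseOn (closesTriangle c) 0 j → Tail c j
initialTail c j none = record
  { base            = 0ℙ
  ; size            = j
  ; step            = id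
  ; step<j          = id
  ; step-open       = λ i<j → none _ z≤n i<j
  ; step-current    = λ i<j → current-initial (<⇒≤ i<j)
  ; step-injective  = λ _ _ e → e
  ; ends-at-current = current-initial ≤-refl
  ; j≤2+size        = m≤n+m j 2
  }
  where
  current-initial : ∀ {i} → i ≤ j → current c i ≡ tailVertex c 0ℙ id i
  current-initial {zero}  _   = refl
  current-initial {suc i} i<j = current-open c (none i z≤n i<j)

retreatTail : ∀ c T → closesTriangle c T ≡ true → FalseOn (closesTriangle c) 0 T → Tail c (suc T)
retreatTail c zero closed _ = record
  { base            = 1ℙ
  ; size            = 0
  ; step            = id
  ; step<j          = λ ()
  ; step-open       = λ ()
  ; step-current    = λ ()
  ; step-injective  = λ ()
  ; ends-at-current = current-first c closed refl
  ; j≤2+size        = s≤s z≤n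
  }
retreatTail c (suc T) closed none = record
  { base            = 0ℙ
  ; size            = T
  ; step            = id
  ; step<j          = λ i<T → m<n⇒m<1+n (m<n⇒m<1+n i<T)
  ; step-open       = λ i<T → step-open (m<n⇒m<1+n i<T)
  ; step-current    = λ i<T → step-current (m<n⇒m<1+n i<T)
  ; step-injective  = λ _ _ e → e
  ; ends-at-current = trans (current-first c closed (open⇒triangleFree c (suc T) none)) (retreat-initial T)
  ; j≤2+size        = ≤-refl
  }
  where
  open Tail (initialTail c (suc T) none) using (step-open; step-current)
  retreat-initial : ∀ T → retreat c (suc T) ≡ tailVertex c 0ℙ id T
  retreat-initial zero    = refl
  retreat-initial (suc k) = refl

retreatTail-avoids : ∀ c T (closed : closesTriangle c T ≡ true) (none : FalseOn (closesTriangle c) 0 T) →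
  Tail.Avoids (retreatTail c T closed none) (current c T)
retreatTail-avoids c zero    _ _    {zero}  _ ()
retreatTail-avoids c (suc T) _ none {zero}  _ e with () ← trans e (current-open c (none T z≤n ≤-refl))
retreatTail-avoids c (suc T) _ none {suc i} i<T e =
  <⇒≢ i<T (cong stepOf (trans e (current-open c (none T z≤n ≤-refl))))

extendAt : (ℕ → A) → ℕ → A → ℕ → A
extendAt f n a i with i <? n
... | yes _ = f i
... | no _  = a

extendAt-< : ∀ (f : ℕ → A) {n a i} → i < n → extendAt f n a i ≡ f i
extendAt-< f {n} {i = i} i<n with i <? n
... | yes _   = refl
... | no i≮n = ⊥-elim (i≮n i<n)

extendAt-≡ : ∀ (f : ℕ → A) n {a} → extendAt f n a n ≡ a
extendAt-≡ f n with n <? n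
... | yes n<n = ⊥-elim (n≮n n n<n)
... | no _    = refl

module Extension {c : Colouring} {j : ℕ} (tl : Tail c j) (notClosed : closesTriangle c j ≡ false) where
  open Tail tl

  step′ : ℕ → ℕ
  step′ = extendAt step size j

  old-step : ∀ {i} → i < size → step′ i ≡ step i
  old-step = extendAt-< step

  new-step : step′ size ≡ j
  new-step = extendAt-≡ step size

  old-vertex : ∀ {i} → i ≤ size → tailVertex c base step′ i ≡ vertex i
  old-vertex {zero}  _   = refl
  old-vertex {suc i} i<n = cong (blueEnd c) (old-step i<n)

  step′<j : ∀ {i} → i < suc size → step′ i < suc j
  step′<j i<1+n with m<1+n⇒m<n∨m≡n i<1+n
  ... | inj₁ i<n  rewrite old-step i<n = m<n⇒m<1+n (step<j i<n)
  ... | inj₂ refl rewrite new-step     = n<1+n j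

  step′-open : ∀ {i} → i < suc size → closesTriangle c (step′ i) ≡ false
  step′-open i<1+n with m<1+n⇒m<n∨m≡n i<1+n
  ... | inj₁ i<n  rewrite old-step i<n = step-open i<n
  ... | inj₂ refl rewrite new-step     = notClosed

  step′-current : ∀ {i} → i < suc size → current c (step′ i) ≡ tailVertex c base step′ i
  step′-current i<1+n with m<1+n⇒m<n∨m≡n i<1+n
  ... | inj₁ i<n  rewrite old-step i<n = trans (step-current i<n) (sym (old-vertex (<⇒≤ i<n)))
  ... | inj₂ refl rewrite new-step     = trans ends-at-current (sym (old-vertex ≤-refl))

  step′-injective : ∀ {i i'} → i < suc size → i' < suc size → step′ i ≡ step′ i' → i ≡ i'
  step′-injective i<1+n i'<1+n e with m<1+n⇒m<n∨m≡n i<1+n | m<1+n⇒m<n∨m≡n i'<1+n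
  ... | inj₁ i<n  | inj₁ i'<n rewrite old-step i<n | old-step i'<n = step-injective i<n i'<n e
  ... | inj₁ i<n  | inj₂ refl rewrite old-step i<n | new-step      = ⊥-elim (<⇒≢ (step<j i<n) e)
  ... | inj₂ refl | inj₁ i'<n rewrite new-step | old-step i'<n     = ⊥-elim (<⇒≢ (step<j i'<n) (sym e))
  ... | inj₂ refl | inj₂ refl = refl

  extended : Tail c (suc j)
  extended = record
    { base            = base
    ; size            = suc size
    ; step            = step′
    ; step<j          = step′<j
    ; step-open       = step′-open
    ; step-current    = step′-current
    ; step-injective  = step′-injective
    ; ends-at-current = trans (current-open c notClosed) (cong (blueEnd c) (sym new-step))
    ; j≤2+size        = s≤s j≤2+size
    }

  extended-avoids : ∀ {x} → Avoids x → blueEnd c j ≢ x → Tail.Avoids extended x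
  extended-avoids avoids new≢x {i} i≤1+n with m≤n⇒m<n∨m≡n i≤1+n
  ... | inj₁ (s≤s i≤n) rewrite old-vertex i≤n = avoids i≤n
  ... | inj₂ refl      rewrite new-step       = new≢x

extendTo : ∀ {c j x} k (tl : Tail c j) → Tail.Avoids tl x → FalseOn (closesTriangle c) j k →
  (∀ {i} → j ≤ i → blueEnd c i ≢ x) → j ≤ k → Σ (Tail c k) λ tl' → Tail.Avoids tl' x
extendTo k tl avoids none new≢x j≤k with m≤n⇒m<n∨m≡n j≤k
... | inj₂ refl = tl , avoids
extendTo {c} (suc k) tl avoids none new≢x _ | inj₁ (s≤s j≤k)
  with tl′ , avoids′ ← extendTo k tl avoids (λ i j≤i i<k → none i j≤i (m<n⇒m<1+n i<k)) new≢x j≤k =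
  Extension.extended tl′ notClosed , Extension.extended-avoids tl′ notClosed avoids′ (new≢x j≤k)
  where
  notClosed : closesTriangle c k ≡ false
  notClosed = none k j≤k (n<1+n k)

tailAfterTriangle : ∀ c {T} j → closesTriangle c T ≡ true → FalseOn (closesTriangle c) 0 T →
  FalseOn (closesTriangle c) (suc T) j → T < j → Σ (Tail c j) λ tl → Tail.Avoids tl (current c T)
tailAfterTriangle c {T} j closed none none′ T<j =
  extendTo j (retreatTail c T closed none) (retreatTail-avoids c T closed none) none′
    (λ T<i → ≢-sym (current≢blueEnd c (<⇒≤ T<i))) T<j

triangles-path-unique : ∀ c {T T₂} (tl : Tail c T₂) → Tail.Avoids tl (current c T) → T < T₂ →
  closesTriangle c T ≡ true → closesTriangle c T₂ ≡ true → ∀ {t} → t ≤ Tail.size tl →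
  Unique (current c T ∷ end T 0ℙ ∷ end T 1ℙ ∷ current c T₂ ∷ end T₂ 0ℙ ∷ end T₂ 1ℙ ∷ map (Tail.vertex tl) (upTo t))
triangles-path-unique c {T} {T₂} tl avoids T<T₂ closed closed₂ {t} t≤n =
  (current≢closedEnd c T closed ∷ current≢closedEnd c T closed ∷
   (λ e → avoids ≤-refl (trans (sym ends-at-current) (sym e))) ∷
   current≢closedEnd c T closed₂ ∷ current≢closedEnd c T closed₂ ∷
   All≢-map-upTo (λ i<t → ≢-sym (avoids (i≤n i<t)))) ∷
  ((λ ()) ∷ ≢-sym (current≢closedEnd c T₂ closed) ∷ T≢T₂ ∷ T≢T₂ ∷
   All≢-map-upTo (λ i<t → ≢-sym (vertex≢closedEnd closed (i≤n i<t)))) ∷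
  (≢-sym (current≢closedEnd c T₂ closed) ∷ T≢T₂ ∷ T≢T₂ ∷
   All≢-map-upTo (λ i<t → ≢-sym (vertex≢closedEnd closed (i≤n i<t)))) ∷
  (current≢closedEnd c T₂ closed₂ ∷ current≢closedEnd c T₂ closed₂ ∷
   All≢-map-upTo (λ i<t e → <⇒≢ (<-≤-trans i<t t≤n)
     (vertex-injective (i≤n i<t) ≤-refl (trans (sym e) ends-at-current)))) ∷
  ((λ ()) ∷ All≢-map-upTo (λ i<t → ≢-sym (vertex≢closedEnd closed₂ (i≤n i<t)))) ∷
  All≢-map-upTo (λ i<t → ≢-sym (vertex≢closedEnd closed₂ (i≤n i<t))) ∷
  Unique-map-upTo vertex t (λ i<t i'<t → vertex-injective (i≤n i<t) (i≤n i'<t))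
  where
  open Tail tl
  i≤n : ∀ {i} → i < t → i ≤ size
  i≤n i<t = <⇒≤ (<-≤-trans i<t t≤n)
  T≢T₂ : ∀ {p q} → end T p ≢ end T₂ q
  T≢T₂ e = <⇒≢ T<T₂ (cong stepOf e)

HasEdge-sym : ∀ {b col x y} → HasEdge b col x y → HasEdge b col y x
HasEdge-sym (inj₁ mem) = inj₂ mem
HasEdge-sym (inj₂ mem) = inj₁ mem

HasEdge-∷ : ∀ {b e col x y} → HasEdge b col x y → HasEdge (e ∷ b) col x y
HasEdge-∷ (inj₁ mem) = inj₁ (there mem)
HasEdge-∷ (inj₂ mem) = inj₂ (there mem)

DragonLink : Board → ℕ → ℕ → ℕ → Set
DragonLink b u w u' = HasEdge b red u w × HasEdge b red w u' × HasEdge b blue u u'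

wishTriangle : ∀ {b u} {v : Parity → ℕ} x y → sameColour x y ≡ true →
  HasEdge b x u (v 0ℙ) → HasEdge b y u (v 1ℙ) → HasEdge b red (v 0ℙ) (v 1ℙ) → WishTriangle b u (v 0ℙ) (v 1ℙ)
wishTriangle red  red  _ e₀ e₁ e₀₁ = red  , red , red  , e₀ , e₀₁ , HasEdge-sym e₁ , inj₁ refl
wishTriangle blue blue _ e₀ e₁ e₀₁ = blue , red , blue , e₀ , e₀₁ , HasEdge-sym e₁ , inj₂ refl

dragonLink : ∀ {b u} {v : Parity → ℕ} x y → sameColour x y ≡ false →
  HasEdge b x u (v 0ℙ) → HasEdge b y u (v 1ℙ) → HasEdge b red (v 0ℙ) (v 1ℙ) →
  DragonLink b u (v (blueSide x ⁻¹)) (v (blueSide x))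
dragonLink red  blue _ e₀ e₁ e₀₁ = e₀ , e₀₁ , e₁
dragonLink blue red  _ e₀ e₁ e₀₁ = e₁ , HasEdge-sym e₀₁ , e₀

_≟ᶜ_ : DecidableEquality Color
red  ≟ᶜ red  = yes refl
blue ≟ᶜ blue = yes refl
red  ≟ᶜ blue = no λ ()
blue ≟ᶜ red  = no λ ()

open import Data.List.Membership.DecPropositional (≡-dec _≟_ (≡-dec _≟_ _≟ᶜ_)) using (_∈?_)

HasEdge? : ∀ b col x y → Dec (HasEdge b col x y)
HasEdge? b col x y = ((x , y , col) ∈? b) ⊎-dec ((y , x , col) ∈? b)

Adj? : ∀ b x y → Dec (Adj b x y)
Adj? b x y with HasEdge? b red x y | HasEdge? b blue x y
... | yes e | _     = yes (red , e)
... | no _  | yes e = yes (blue , e)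
... | no ¬r | no ¬b = no λ { (red , e) → ¬r e ; (blue , e) → ¬b e }

Fresh : Board → ℕ × ℕ → Set
Fresh b e = (proj₁ e ≢ proj₂ e) × ¬ Adj b (proj₁ e) (proj₂ e)

Fresh? : ∀ b e → Dec (Fresh b e)
Fresh? b e = ¬? (proj₁ e ≟ proj₂ e) ×-dec ¬? (Adj? b (proj₁ e) (proj₂ e))

endpoints : Board → List ℕ
endpoints []              = []
endpoints ((u , v , _) ∷ b) = u ∷ v ∷ endpoints b

∈-endpoints : ∀ {b u v col} → (u , v , col) ∈ b → u ∈ endpoints b × v ∈ endpoints b
∈-endpoints (here refl) = here refl , there (here refl)
∈-endpoints {_ ∷ _} (there mem) with u∈ , v∈ ← ∈-endpoints mem = there (there u∈) , there (there v∈)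

unusedEdge : ∀ b → Σ (ℕ × ℕ) (Fresh b)
unusedEdge b = (above vs 0 , above vs 1) , (λ e → 0≢1+n (above-injective vs e)) , unused
  where
  vs : List ℕ
  vs = endpoints b
  unused : ¬ Adj b (above vs 0) (above vs 1)
  unused (_ , inj₁ mem) = above-∉ vs 0 (proj₁ (∈-endpoints mem))
  unused (_ , inj₂ mem) = above-∉ vs 1 (proj₁ (∈-endpoints mem))

choose : ∀ b → ℕ × ℕ → Σ (ℕ × ℕ) (Fresh b)
choose b e with Fresh? b e
... | yes fresh = e , fresh
... | no _      = unusedEdge b

choose-fresh : ∀ {b e} → Fresh b e → proj₁ (choose b e) ≡ e
choose-fresh {b} {e} fresh with Fresh? b e
... | yes _     = refl
... | no ¬fresh = ⊥-elim (¬fresh fresh)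

∈-redBoard⁻ : ∀ {H e} d → e ∈ redBoard H →
  ∃ λ j → e ≡ (prepend (verts H) d (round j 0ℙ) , prepend (verts H) d (round j 1ℙ) , red)
∈-redBoard⁻ {_ ∷ _} d (here refl)  = 0 , refl
∈-redBoard⁻ {_ ∷ _} d (there mem) with j , e ← ∈-redBoard⁻ (d ∘ suc ∘ suc) mem = suc j , e

∈-redBoard⁺ : ∀ {H j} d → j < length H →
  (prepend (verts H) d (round j 0ℙ) , prepend (verts H) d (round j 1ℙ) , red) ∈ redBoard H
∈-redBoard⁺ {_ ∷ _} {zero}  d _         = here refl
∈-redBoard⁺ {_ ∷ _} {suc j} d (s≤s j<m) = there (∈-redBoard⁺ (d ∘ suc ∘ suc) j<m)

-- Colour of the i-th newest entry of a board; red past its end.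
colourAt : Board → ℕ → Color
colourAt []                  _       = red
colourAt ((_ , _ , col) ∷ _) zero    = col
colourAt (_ ∷ b)             (suc i) = colourAt b i

module Strategy (H : List (ℕ × ℕ)) (s₁ s₂ : ℕ) (distinct : Unique (s₁ ∷ s₂ ∷ verts H)) where

  names : List ℕ
  names = s₁ ∷ s₂ ∷ verts H

  ⟦_⟧ : Label → ℕ
  ⟦ l ⟧ = prepend names (above names) (slot l)

  ⟦⟧-injective : ∀ {l l'} → ⟦ l ⟧ ≡ ⟦ l' ⟧ → l ≡ l'
  ⟦⟧-injective {l} {l'} e = slot-injective
    (prepend-injective {xs = names} {d = above names} distinct (above-injective names) (above-∉ names) {slot l} {slot l'} e)

  root-InPair : ∀ p → InPair s₁ s₂ ⟦ root p ⟧
  root-InPair 0ℙ = inj₁ refl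
  root-InPair 1ℙ = inj₂ refl

  m : ℕ
  m = length H

  -- The board after r rounds has r + m entries, and round r' < r is at depth r ∸ suc r'.
  history : Board → Colouring
  history b r' = colourAt b ((length b ∸ m) ∸ suc r')

  target : ℕ → Label
  target r = end ⌊ r /2⌋ (parity r)

  move : Colouring → ℕ → ℕ × ℕ
  move c r = ⟦ current c ⌊ r /2⌋ ⟧ , ⟦ target r ⟧

  -- Opaque, so that boards play H builder π r are not unfolded during type checking.
  opaque
    builder : Builder
    builder b = choose b (move (history b) (length b ∸ m))

  born-target : ∀ r → born (target r) ≡ suc r
  born-target r = cong suc (round-⌊/2⌋ r)

  born-current-≤ : ∀ c r → born (current c ⌊ r /2⌋) ≤ r
  born-current-≤ c r = ≤-trans (born-current c ⌊ r /2⌋) (double⌊/2⌋≤ r)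

  not-target : ∀ {l r} → born l ≤ r → l ≢ target r
  not-target {r = r} born≤r e = 1+n≰n (subst (_≤ r) (trans (cong born e) (born-target r)) born≤r)

  Known : ℕ → ℕ × ℕ × Color → Set
  Known r e = (∃ λ j → e ≡ (⟦ end j 0ℙ ⟧ , ⟦ end j 1ℙ ⟧ , red)) ⊎
              (∃ λ l → ∃ λ l' → ∃ λ col → e ≡ (⟦ l ⟧ , ⟦ l' ⟧ , col) × born l ≤ r × born l' ≤ r)

  Known-suc : ∀ {r e} → Known r e → Known (suc r) e
  Known-suc (inj₁ matching)                 = inj₁ matching
  Known-suc (inj₂ (l , l' , col , e , b , b')) = inj₂ (l , l' , col , e , m≤n⇒m≤1+n b , m≤n⇒m≤1+n b')

  target-partner : ∀ {r x y col} → Known r (x , y , col) →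
    (x ≡ ⟦ target r ⟧ → ∃ λ q → y ≡ ⟦ end ⌊ r /2⌋ q ⟧) × (y ≡ ⟦ target r ⟧ → ∃ λ q → x ≡ ⟦ end ⌊ r /2⌋ q ⟧)
  target-partner {r} (inj₁ (j , refl)) =
    (λ e → 1ℙ , cong (λ i → ⟦ end i 1ℙ ⟧) (cong stepOf (⟦⟧-injective {end j 0ℙ} {target r} e))) ,
    (λ e → 0ℙ , cong (λ i → ⟦ end i 0ℙ ⟧) (cong stepOf (⟦⟧-injective {end j 1ℙ} {target r} e)))
  target-partner {r} (inj₂ (l , l' , _ , refl , b , b')) =
    (λ e → ⊥-elim (not-target b (⟦⟧-injective {l} {target r} e))) ,
    (λ e → ⊥-elim (not-target b' (⟦⟧-injective {l'} {target r} e)))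

  module Play (π : Painter) where

    board : ℕ → Board
    board = play H builder π

    colour : Colouring
    colour r = π (board r) (proj₁ (builder (board r)))

    length-board : ∀ r → length (board r) ≡ r + m
    length-board zero    = length-map _ H
    length-board (suc r) = cong suc (length-board r)

    colourAt-board : ∀ {r r'} → r' < r → colourAt (board r) (r ∸ suc r') ≡ colour r'
    colourAt-board {suc r} {r'} r'<1+r with m<1+n⇒m<n∨m≡n r'<1+r
    ... | inj₂ refl rewrite n∸n≡0 r        = refl
    ... | inj₁ r'<r rewrite +-∸-assoc 1 r'<r = colourAt-board r'<r

    history-board : ∀ r → AgreeBelow r (history (board r)) colour
    history-board r {r'} r'<r =
      trans (cong (λ n → colourAt (board r) ((n ∸ m) ∸ suc r')) (length-board r))
            (trans (cong (λ n → colourAt (board r) (n ∸ suc r')) (m+n∸n≡m r m)) (colourAt-board r'<r))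

    move-board : ∀ r → move (history (board r)) (length (board r) ∸ m) ≡ move colour r
    move-board r =
      trans (cong (move (history (board r))) (trans (cong (_∸ m) (length-board r)) (m+n∸n≡m r m)))
            (cong (λ l → ⟦ l ⟧ , ⟦ target r ⟧) (current-cong ⌊ r /2⌋ (AgreeBelow-≤ (double⌊/2⌋≤ r) (history-board r))))

    move-fresh : ∀ r → (∀ {e} → e ∈ board r → Known r e) → Fresh (board r) (move colour r)
    move-fresh r known = distinct-ends , not-adjacent
      where
      distinct-ends : ⟦ current colour ⌊ r /2⌋ ⟧ ≢ ⟦ target r ⟧
      distinct-ends e = not-target (born-current-≤ colour r) (⟦⟧-injective {current colour ⌊ r /2⌋} {target r} e)
      not-adjacent : ¬ Adj (board r) ⟦ current colour ⌊ r /2⌋ ⟧ ⟦ target r ⟧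
      not-adjacent (_ , inj₁ mem) =
        let q , e = proj₂ (target-partner {r} {⟦ current colour ⌊ r /2⌋ ⟧} {⟦ target r ⟧} (known mem)) refl
        in current≢end colour ⌊ r /2⌋ q (⟦⟧-injective {current colour ⌊ r /2⌋} {end ⌊ r /2⌋ q} e)
      not-adjacent (_ , inj₂ mem) =
        let q , e = proj₁ (target-partner {r} {⟦ target r ⟧} {⟦ current colour ⌊ r /2⌋ ⟧} (known mem)) refl
        in current≢end colour ⌊ r /2⌋ q (⟦⟧-injective {current colour ⌊ r /2⌋} {end ⌊ r /2⌋ q} e)

    opaque
      unfolding builder

      selected-if-known : ∀ r → (∀ {e} → e ∈ board r → Known r e) → proj₁ (builder (board r)) ≡ move colour r
      selected-if-known r known =
        trans (choose-fresh (subst (Fresh (board r)) (sym (move-board r)) (move-fresh r known))) (move-board r)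

    known : ∀ r {e} → e ∈ board r → Known r e
    known zero    mem = inj₁ (∈-redBoard⁻ (above names ∘ suc ∘ suc) mem)
    known (suc r) (here refl)  = inj₂ (current colour ⌊ r /2⌋ , target r , colour r ,
      cong (λ e → proj₁ e , proj₂ e , colour r) (selected-if-known r (known r)) ,
      m≤n⇒m≤1+n (born-current-≤ colour r) , ≤-reflexive (born-target r))
    known (suc r) (there mem) = Known-suc (known r mem)

    selected : ∀ r → proj₁ (builder (board r)) ≡ move colour r
    selected r = selected-if-known r (known r)

    new-edge : ∀ r → HasEdge (board (suc r)) (colour r) ⟦ current colour ⌊ r /2⌋ ⟧ ⟦ target r ⟧
    new-edge r = inj₁ (here (cong (λ e → proj₁ e , proj₂ e , colour r) (sym (selected r))))

    board-mono : ∀ {r r' col x y} → r ≤ r' → HasEdge (board r) col x y → HasEdge (board r') col x y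
    board-mono {r' = r'} r≤r' e with m≤n⇒m<n∨m≡n r≤r'
    ... | inj₂ refl = e
    board-mono {r' = suc r'} _ e | inj₁ (s≤s r≤r') = HasEdge-∷ (board-mono r≤r' e)

    matching-edge : ∀ {j} r → j < m → HasEdge (board r) red ⟦ end j 0ℙ ⟧ ⟦ end j 1ℙ ⟧
    matching-edge r j<m = board-mono {0} {r} z≤n (inj₁ (∈-redBoard⁺ (above names ∘ suc ∘ suc) j<m))

    step-edge : ∀ j p → HasEdge (board (double (suc j))) (colour (round j p)) ⟦ current colour j ⟧ ⟦ end j p ⟧
    step-edge j p = board-mono (born-end j p)
      (subst₂ (λ i q → HasEdge (board (suc (round j p))) (colour (round j p)) ⟦ current colour i ⟧ ⟦ end i q ⟧)
              (⌊round/2⌋ j p) (parity-round j p) (new-edge (round j p)))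

    triangle-at : ∀ {j} → closesTriangle colour j ≡ true → j < m →
      WishTriangle (board (double (suc j))) ⟦ current colour j ⟧ ⟦ end j 0ℙ ⟧ ⟦ end j 1ℙ ⟧
    triangle-at {j} closed j<m = wishTriangle {v = λ p → ⟦ end j p ⟧} (colour (round j 0ℙ)) (colour (round j 1ℙ))
      closed (step-edge j 0ℙ) (step-edge j 1ℙ) (matching-edge (double (suc j)) j<m)

    link-at : ∀ {j} → closesTriangle colour j ≡ false → j < m →
      DragonLink (board (double (suc j))) ⟦ current colour j ⟧ ⟦ redEnd colour j ⟧ ⟦ blueEnd colour j ⟧
    link-at {j} notClosed j<m = dragonLink {v = λ p → ⟦ end j p ⟧} (colour (round j 0ℙ)) (colour (round j 1ℙ))
      notClosed (step-edge j 0ℙ) (step-edge j 1ℙ) (matching-edge (double (suc j)) j<m)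

    DragonLink-mono : ∀ {r r' u w u'} → r ≤ r' → DragonLink (board r) u w u' → DragonLink (board r') u w u'
    DragonLink-mono r≤r' (e₁ , e₂ , e₃) = board-mono r≤r' e₁ , board-mono r≤r' e₂ , board-mono r≤r' e₃

    WishTriangle-mono : ∀ {r r' x y z} → r ≤ r' → WishTriangle (board r) x y z → WishTriangle (board r') x y z
    WishTriangle-mono r≤r' (c₁ , c₂ , c₃ , e₁ , e₂ , e₃ , wish) =
      c₁ , c₂ , c₃ , board-mono r≤r' e₁ , board-mono r≤r' e₂ , board-mono r≤r' e₃ , wish

    tail-link : ∀ {j} (tl : Tail colour j) → j ≤ m → ∀ {i} → i < Tail.size tl →
      DragonLink (board (double j)) ⟦ Tail.vertex tl i ⟧ ⟦ redEnd colour (Tail.step tl i) ⟧ ⟦ Tail.vertex tl (suc i) ⟧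
    tail-link tl j≤m {i} i<n = DragonLink-mono (double-mono-≤ (step<j i<n))
      (subst (λ l → DragonLink (board (double (suc (step i)))) ⟦ l ⟧ ⟦ redEnd colour (step i) ⟧ ⟦ blueEnd colour (step i) ⟧)
             (step-current i<n) (link-at (step-open i<n) (<-≤-trans (step<j i<n) j≤m)))
      where open Tail tl

    dragon : ∀ {j ℓ} (tl : Tail colour j) → j ≤ m → ℓ ≤ Tail.size tl → DragonTail (board (double j)) ℓ s₁ s₂
    dragon {j} {ℓ} tl j≤m ℓ≤n = u , w , ++⁺ unique-u unique-w disjoint , links , root-InPair base
      where
      open Tail tl
      u w : ℕ → ℕ
      u i = ⟦ vertex i ⟧
      w i = ⟦ redEnd colour (step (pred i)) ⟧  -- only w (suc i) is used
      unique-u : Unique (map u (upTo (suc ℓ)))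
      unique-u = Unique-map-upTo u (suc ℓ) λ {i} {i'} i<1+ℓ i'<1+ℓ e →
        vertex-injective (≤-trans (≤-pred i<1+ℓ) ℓ≤n) (≤-trans (≤-pred i'<1+ℓ) ℓ≤n) (⟦⟧-injective {vertex i} {vertex i'} e)
      unique-w : Unique (map (w ∘ suc) (upTo ℓ))
      unique-w = Unique-map-upTo (w ∘ suc) ℓ λ {i} {i'} i<ℓ i'<ℓ e →
        step-injective (<-≤-trans i<ℓ ℓ≤n) (<-≤-trans i'<ℓ ℓ≤n)
          (cong stepOf (⟦⟧-injective {redEnd colour (step i)} {redEnd colour (step i')} e))
      disjoint : Disjoint (map u (upTo (suc ℓ))) (map (w ∘ suc) (upTo ℓ))
      disjoint (mem , mem′) =
        let i , _ , e  = ∈-map-upTo⁻ {f = u} mem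
            k , _ , e′ = ∈-map-upTo⁻ {f = w ∘ suc} mem′
        in vertex≢redEnd i (step k) (⟦⟧-injective {vertex i} {redEnd colour (step k)} (trans (sym e) e′))
      links : ∀ i → i < ℓ → DragonLink (board (double j)) (u i) (w (suc i)) (u (suc i))
      links i i<ℓ = tail-link tl j≤m (<-≤-trans i<ℓ ℓ≤n)

    twoTriangles : ∀ {T T₂} → T < T₂ → T₂ < m →
      closesTriangle colour T ≡ true → closesTriangle colour T₂ ≡ true →
      FalseOn (closesTriangle colour) 0 T → FalseOn (closesTriangle colour) (suc T) T₂ →
      OutcomeI (board (double (suc T₂))) s₁ s₂ (T₂ ∸ 2)
    twoTriangles {T} {T₂} T<T₂ T₂<m closed closed₂ none none₂
      with tl , avoids ← tailAfterTriangle colour T₂ closed none none₂ T<T₂ =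
      ⟦ current colour T ⟧ , ⟦ end T 0ℙ ⟧ , ⟦ end T 1ℙ ⟧ ,
      ⟦ current colour T₂ ⟧ , ⟦ end T₂ 0ℙ ⟧ , ⟦ end T₂ 1ℙ ⟧ , ⟦_⟧ ∘ vertex ,
      subst (λ xs → Unique (⟦ current colour T ⟧ ∷ ⟦ end T 0ℙ ⟧ ∷ ⟦ end T 1ℙ ⟧ ∷
                            ⟦ current colour T₂ ⟧ ∷ ⟦ end T₂ 0ℙ ⟧ ∷ ⟦ end T₂ 1ℙ ⟧ ∷ xs))
            (sym (map-∘ (upTo t)))
            (map⁺ (λ {l} {l'} → ⟦⟧-injective {l} {l'}) (triangles-path-unique colour tl avoids T<T₂ closed closed₂ t≤n)) ,
      WishTriangle-mono (double-mono-≤ (s≤s (<⇒≤ T<T₂))) (triangle-at closed (<-trans T<T₂ T₂<m)) ,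
      triangle-at closed₂ T₂<m ,
      (λ i 1+i<t → proj₂ (proj₂ (DragonLink-mono (double-mono-≤ (n≤1+n T₂))
                                  (tail-link tl (<⇒≤ T₂<m) (<-≤-trans (<-trans (n<1+n i) 1+i<t) t≤n))))) ,
      (λ _ → inj₁ (root-InPair base))
      where
      open Tail tl
      t : ℕ
      t = T₂ ∸ 2
      t≤n : t ≤ size
      t≤n = m≤n+o⇒m∸n≤o T₂ 2 j≤2+size

    dragonAtEnd : (tl : Tail colour m) → DragonTail (board (2 * m)) (m ∸ 2) s₁ s₂
    dragonAtEnd tl = subst (λ r → DragonTail (board r) (m ∸ 2) s₁ s₂) (double≡2* m)
      (dragon tl ≤-refl (m≤n+o⇒m∸n≤o m 2 (Tail.j≤2+size tl)))

    outcome : (Σ ℕ λ t → t < m × Σ ℕ λ r → r ≤ 2 * t + 6 × OutcomeI (board r) s₁ s₂ t) ⊎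
              DragonTail (board (2 * m)) (m ∸ 2) s₁ s₂
    outcome with first-true (closesTriangle colour) 0 m
    ... | inj₁ none = inj₂ (dragonAtEnd (initialTail colour m none))
    ... | inj₂ (T , _ , T<m , closed , none) with first-true (closesTriangle colour) (suc T) m
    ...   | inj₁ none₂ = inj₂ (dragonAtEnd (proj₁ (tailAfterTriangle colour m closed none none₂ T<m)))
    ...   | inj₂ (T₂ , T<T₂ , T₂<m , closed₂ , none₂) =
      inj₁ (T₂ ∸ 2 , ≤-<-trans (m∸n≤m T₂ 2) T₂<m , double (suc T₂) , rounds-bound T₂ ,
            twoTriangles T<T₂ T₂<m closed closed₂ none none₂)
      where
      rounds-bound : ∀ T₂ → double (suc T₂) ≤ 2 * (T₂ ∸ 2) + 6
      rounds-bound zero          = s≤s (s≤s z≤n)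
      rounds-bound (suc zero)    = s≤s (s≤s (s≤s (s≤s z≤n)))
      rounds-bound (suc (suc q)) = ≤-reflexive (trans (cong (6 +_) (double≡2* q)) (+-comm 6 (2 * q)))

-- The strategy reaches (i) or (ii) in every play.
lemma17 : (k n m : ℕ) → 3 ≤ k → 3 ≤ n →
    (H : List (ℕ × ℕ)) → length H ≡ m → IsMatching H →
    (s₁ s₂ : ℕ) → s₁ ≢ s₂ → s₁ ∉ verts H → s₂ ∉ verts H →
    Σ Builder λ β → (π : Painter) →
      (Σ ℕ λ t → t < m × Σ ℕ λ r → r ≤ 2 * t + 6 ×
         (Ended k n (play H β π r) ⊎ OutcomeI (play H β π r) s₁ s₂ t))
      ⊎
      (Ended k n (play H β π (2 * m)) ⊎ DragonTail (play H β π (2 * m)) (m ∸ 2) s₁ s₂)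
lemma17 _ _ _ _ _ H refl matching s₁ s₂ s₁≢s₂ s₁∉H s₂∉H = builder , λ π →
  Sum.map (λ (t , t<m , r , r≤ , outcomeI) → t , t<m , r , r≤ , inj₂ outcomeI) inj₂ (Play.outcome π)
  where
  open Strategy H s₁ s₂ ((s₁≢s₂ ∷ ¬Any⇒All¬ _ s₁∉H) ∷ ¬Any⇒All¬ _ s₂∉H ∷ matching)
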